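{- Let $\mathcal H^0_{\mathbb Z}\subseteq\mathcal H_{\mathbb Z}$ be the $\mathbb Q$-linear span of $\mathbf 1$ together with all $[s_1,\dots,s_k]$ ($k\ge1$, $s_i\in\mathbb Z$) satisfying $s_1+\cdots+s_j>j$ for every $j=1,\dots,k$. Then $\mathcal H^0_{\mathbb Z}$ is closed under the extended shuffle product $\sqcup\!\sqcup$, so that $(\mathcal H^0_{\mathbb Z},\sqcup\!\sqcup)$ is a subalgebra of $(\mathcal H_{\mathbb Z},\sqcup\!\sqcup)$.
   Context: Let $\mathcal H_{\mathbb Z}$ be the $\mathbb Q$-vector space with basis $\mathbf 1$ together with the formal symbols $[s_1,\dots,s_k]$ for $k\ge1$ and $(s_1,\dots,s_k)\in\mathbb Z^k$. The depth of $[s_1,\dots,s_k]$ is $k$, and the depth of $\mathbf 1$ is $0$. Define linear maps on basis elements of positive depth by $I([s_1,s_2,\dots,s_k])=[s_1+1,s_2,\dots,s_k]$ and $J([s_1,s_2,\dots,s_k])=[s_1-1,s_2,\dots,s_k]$, and set $J(\mathbf 1)=0$. Notation: for a basis element $[s_1,\dots,s_k]$ of positive depth, $[\vec s\,']$ denotes $[s_2,\dots,s_k]$, or $\mathbf 1$ if $k=1$, and we write $[s_1,\dots,s_k]=[s_1,\vec s\,']$. For $a\in\mathbb Z$ and $X=\sum c_{\vec v}[\vec v]$ (where $\mathbf 1$ may occur), put $[a,X]:=\sum c_{\vec v}[a,\vec v]$, with the convention $[a,\mathbf 1]:=[a]$. The extended shuffle product $\sqcup\!\sqcup$ is the bilinear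 product on $\mathcal H_{\mathbb Z}$ with two-sided unit $\mathbf 1$, defined on basis elements $[s_1,\vec s\,']$, $[t_1,\vec t\,']$ of positive depth by the following recursions: <ul> <li>(i) if $s_1=0$: $[0,\vec s\,']\sqcup\!\sqcup[t_1,\vec t\,']=[0,[\vec s\,']\sqcup\!\sqcup[t_1,\vec t\,']]$;</li> <li>(ii) if $s_1>0$ and $t_1=0$: $[s_1,\vec s\,']\sqcup\!\sqcup[0,\vec t\,']=[0,[s_1,\vec s\,']\sqcup\!\sqcup[\vec t\,']]$;</li> <li>(iii) if $s_1>0$ and $t_1>0$: $[s_1,\vec s\,']\sqcup\!\sqcup[t_1,\vec t\,']=I([s_1,\vec s\,']\sqcup\!\sqcup[t_1-1,\vec t\,'])+I([s_1-1,\vec s\,']\sqcup\!\sqcup[t_1,\vec t\,'])$;</li> <li>(iv) if $s_1>0$ and $t_1<0$: $[s_1,\vec s\,']\sqcup\!\sqcup[t_1,\vec t\,']=J([s_1,\vec s\,']\sqcup\!\sqcup[t_1+1,\vec t\,'])-[s_1-1,\vec s\,']\sqcup\!\sqcup[t_1+1,\vec t\,']$;</li> <li>(v) if $s_1<0$: $[s_1,\vec s\,']\sqcup\!\sqcup[t_1,\vec t\,']=J([s_1+1,\vec s\,']\sqcup\!\sqcup[t_1,\vec t\,'])-[s_1+1,\vec s\,']\sqcup\!\sqcup[t_1-1,\vec t\,']$.</li> </ul> The recursions are well founded: (i) and (ii) proceed by induction on total depth, (iii) by induction on $s_1+t_1$, (iv) on $|t_1|$, and (v) on $|s_1|$. 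-}

module Defs where

open import Data.Nat using (ℕ; zero; suc; _≤_)
open import Data.Empty using (⊥)
open import Relation.Binary.PropositionalEquality using (_≡_)
open import Data.Integer as ℤ using (ℤ; +_; -[1+_]; +[1+_])
open import Data.Integer.Properties as ℤP using ()
open import Data.Rational as ℚ using (ℚ; 0ℚ; 1ℚ)
open import Data.List using (List; []; _∷_; map; concatMap; _++_; length; take)
open import Data.Product using (_×_; _,_)
open import Data.Bool using (if_then_else_)
open import Relation.Nullary.Decidable using (⌊_⌋)
open import Data.List.Properties using (≡-dec)

-- A basis word: [] is the unit 𝟏, (s₁ ∷ … ∷ sₖ) is [s₁,…,sₖ].
Word : Set
Word = List ℤ

-- An element of H_ℤ: a finite formal ℚ-linear combination of words
-- (terms may repeat / cancel; only the coefficient function matters).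
Lin : Set
Lin = List (ℚ × Word)

coeff : Word → Lin → ℚ
coeff w [] = 0ℚ
coeff w ((q , v) ∷ X) =
  (if ⌊ ≡-dec ℤ._≟_ v w ⌋ then q else 0ℚ) ℚ.+ coeff w X

unit : Word → Lin
unit w = (1ℚ , w) ∷ []

neg : Lin → Lin
neg = map (λ { (q , v) → (ℚ.- q , v) })

_⊕_ : Lin → Lin → Lin
_⊕_ = _++_

_⊖_ : Lin → Lin → Lin
X ⊖ Y = X ++ neg Y

prepend : ℤ → Lin → Lin
prepend a = map (λ { (q , v) → (q , a ∷ v) })

-- I and J on words of positive depth; J(𝟏) = 0 (I is only ever applied
-- to combinations of positive-depth words; we also send 𝟏 to 0 there).
Iw : Word → Lin
Iw [] = []
Iw (s ∷ v) = unit (ℤ.suc s ∷ v)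

Jw : Word → Lin
Jw [] = []
Jw (s ∷ v) = unit (ℤ.pred s ∷ v)

linMap : (Word → Lin) → Lin → Lin
linMap f = concatMap (λ { (q , v) → map (λ { (r , w) → (q ℚ.* r , w) }) (f v) })

I J : Lin → Lin
I = linMap Iw
J = linMap Jw

-- The extended shuffle product on words, following recursions (i)–(v).
mutual
  shL : Word → Word → Lin
  shL [] t = unit t
  shL (x ∷ s) t = shH x s t

  shH : ℤ → Word → Word → Lin
  shH x s [] = unit (x ∷ s)
  shH x s (y ∷ t) = shC x s y t

  shC : ℤ → Word → ℤ → Word → Lin
  shC (+ zero) s y t = shZ s y t
  shC +[1+ n ] s y t = shP n s y t
  shC -[1+ n ] s y t = shN n s y t

  shZ : Word → ℤ → Word → Lin
  shZ s y t = prepend (+ 0) (shL s (y ∷ t))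

  shN : ℕ → Word → ℤ → Word → Lin
  shN zero s y t = J (shZ s y t) ⊖ shZ s (ℤ.pred y) t
  shN (suc n) s y t = J (shN n s y t) ⊖ shN n s (ℤ.pred y) t

  shP : ℕ → Word → ℤ → Word → Lin
  shP n s (+ zero) t = shP0 n s t
  shP n s +[1+ m ] t = shPP n m s t
  shP n s -[1+ m ] t = shPN n m s t

  shP0 : ℕ → Word → Word → Lin
  shP0 n s t = prepend (+ 0) (shH +[1+ n ] s t)

  -- (iii): s₁ = n+1, t₁ = m+1 :
  --   I((s₁ ∷ s) ⧢ (t₁-1 ∷ t)) + I((s₁-1 ∷ s) ⧢ (t₁ ∷ t))
  shPP : ℕ → ℕ → Word → Word → Lin
  shPP zero    zero    s t = I (shP0 zero s t) ⊕ I (shZ s (+ 1) t)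
  shPP zero    (suc m) s t = I (shPP zero m s t) ⊕ I (shZ s +[1+ suc m ] t)
  shPP (suc n) zero    s t = I (shP0 (suc n) s t) ⊕ I (shPP n zero s t)
  shPP (suc n) (suc m) s t = I (shPP (suc n) m s t) ⊕ I (shPP n (suc m) s t)

  -- (iv): s₁ = n+1, t₁ = -(m+1) :
  --   J((s₁ ∷ s) ⧢ (t₁+1 ∷ t)) - (s₁-1 ∷ s) ⧢ (t₁+1 ∷ t)
  shPN : ℕ → ℕ → Word → Word → Lin
  shPN zero    zero    s t = J (shP0 zero s t) ⊖ shZ s (+ 0) t
  shPN (suc n) zero    s t = J (shP0 (suc n) s t) ⊖ shP0 n s t
  shPN zero    (suc m) s t = J (shPN zero m s t) ⊖ shZ s -[1+ m ] t
  shPN (suc n) (suc m) s t = J (shPN (suc n) m s t) ⊖ shPN n m s t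

_⧢_ : Lin → Lin → Lin
X ⧢ Y = concatMap (λ { (p , v) → concatMap (λ { (q , w) →
          map (λ { (r , u) → (p ℚ.* q ℚ.* r , u) }) (shL v w) }) Y }) X

sumℤ : List ℤ → ℤ
sumℤ [] = + 0
sumℤ (x ∷ xs) = x ℤ.+ sumℤ xs

Admissible : Word → Set
Admissible w = (j : ℕ) → 1 ≤ j → j ≤ length w → sumℤ (take j w) ℤ.> + j

-- X lies in H⁰_ℤ: the span of the admissible words, i.e. every
-- non-admissible word has coefficient 0 in X.
InH0 : Lin → Set
InH0 X = (w : Word) → (Admissible w → ⊥) → coeff w X ≡ 0ℚ

{-# OPTIONS --safe #-}

-- Call m(w) = min over j ≥ 1 of (s₁ + ⋯ + sⱼ) − j the margin of a word w = [s₁,…,sₖ]; H⁰ is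
-- spanned by 𝟏 and the words of margin ≥ 1. Along each recursion (i)–(v) the first letters move by
-- ±1 and I, J move the margin of every word by ±1, and an induction following the recursions shows
-- that every word occurring in [s] ⧢ [t] has margin ≥ r whenever r ≤ m(s), r ≤ m(t) and
-- r ≤ m(s) + m(t); with m(s), m(t) ≥ 1 we may take r = 1. This settles basis words; for general
-- X, Y the non-admissible terms of X and Y need not be absent, only cancel, so one shows that a
-- combination with all coefficients zero pairs to zero with any function on words.

module Submission where

open import Data.List using ([]; _∷_; _++_; map; concatMap; filter; length; take)
open import Data.List.Relation.Unary.All as All using (All; []; _∷_)
open import Data.List.Relation.Unary.All.Properties using (++⁺; map⁺)
open import Data.Product using (_×_; _,_; proj₂; uncurry)
open import Function using (_∘_; _⇔_; mk⇔; Equivalence)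
open import Relation.Binary.PropositionalEquality using (_≡_; refl; sym; subst)
open import Relation.Nullary using (Dec; yes; no; _×-dec_)
import Relation.Nullary.Decidable as Dec
open import Relation.Unary using (Decidable)

open import Defs

AllWords : (Word → Set) → Lin → Set
AllWords P = All (P ∘ proj₂)

module Coefficients where

  open import Data.Nat using (suc; s≤s; _≤_)
  import Data.Nat.Properties as ℕ
  open import Data.Bool using (if_then_else_)
  open import Data.Empty using (⊥-elim)
  open import Data.Integer using (_≟_)
  open import Data.List.Properties using (≡-dec; length-filter; filter-reject)
  open import Data.List.Relation.Unary.All.Properties using (all-filter)
  open import Data.Rational using (ℚ; 0ℚ; _+_; _*_)
  open import Data.Rational.Properties
    using (+-identityˡ; +-assoc; *-assoc; *-comm; *-zeroˡ; *-zeroʳ; *-distribˡ-+; *-distribʳ-+;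
           +-0-commutativeMonoid; *-1-commutativeMonoid)
  open import Algebra.Bundles using (CommutativeMonoid)
  open import Algebra.Properties.CommutativeSemigroup
    (CommutativeMonoid.commutativeSemigroup +-0-commutativeMonoid) using ()
    renaming (x∙yz≈y∙xz to x+[y+z]≡y+[x+z])
  open import Algebra.Properties.CommutativeSemigroup
    (CommutativeMonoid.commutativeSemigroup *-1-commutativeMonoid) using ()
    renaming (x∙yz≈y∙xz to x*[y*z]≡y*[x*z])
  open import Relation.Binary.PropositionalEquality using (cong; cong₂; trans; module ≡-Reasoning)
  open import Relation.Nullary using (¬_; ¬?)
  open import Relation.Nullary.Decidable using (⌊_⌋)
  open ≡-Reasoning

  weightedSum : (Word → ℚ) → Lin → ℚ
  weightedSum g []            = 0ℚ
  weightedSum g ((p , v) ∷ X) = p * g v + weightedSum g X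

  restrict : ∀ {P : Word → Set} → Decidable P → Lin → Lin
  restrict P? = filter (P? ∘ proj₂)

  termCoeff : Word → ℚ × Word → ℚ
  termCoeff w (q , v) = if ⌊ ≡-dec _≟_ v w ⌋ then q else 0ℚ

  coeff-++ : ∀ w X Y → coeff w (X ++ Y) ≡ coeff w X + coeff w Y
  coeff-++ w []            Y = sym (+-identityˡ _)
  coeff-++ w (e ∷ X)       Y =
    trans (cong (termCoeff w e +_) (coeff-++ w X Y)) (sym (+-assoc (termCoeff w e) (coeff w X) (coeff w Y)))

  coeff-scale : ∀ w c (f : ℚ × Word → ℚ × Word) → (∀ r u → f (r , u) ≡ (c * r , u)) →
                ∀ X → coeff w (map f X) ≡ c * coeff w X
  coeff-scale w c f f≗scale []            = sym (*-zeroʳ c)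
  coeff-scale w c f f≗scale ((r , u) ∷ X) rewrite f≗scale r u with ≡-dec _≟_ u w
  ... | yes _ = trans (cong (c * r +_) (coeff-scale w c f f≗scale X)) (sym (*-distribˡ-+ c r _))
  ... | no  _ = trans (cong (0ℚ +_) (coeff-scale w c f f≗scale X))
                      (trans (cong (_+ c * coeff w X) (sym (*-zeroʳ c))) (sym (*-distribˡ-+ c 0ℚ _)))

  coeff-concatMap : ∀ w (h : ℚ × Word → Lin) g → (∀ p v → coeff w (h (p , v)) ≡ p * g v) →
                    ∀ X → coeff w (concatMap h X) ≡ weightedSum g X
  coeff-concatMap w h g h≗ []            = refl
  coeff-concatMap w h g h≗ ((p , v) ∷ X) =
    trans (coeff-++ w (h (p , v)) (concatMap h X)) (cong₂ _+_ (h≗ p v) (coeff-concatMap w h g h≗ X))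

  weightedSum-scale : ∀ c g X → weightedSum (λ v → c * g v) X ≡ c * weightedSum g X
  weightedSum-scale c g []            = sym (*-zeroʳ c)
  weightedSum-scale c g ((p , v) ∷ X) = begin
    p * (c * g v) + weightedSum (λ v → c * g v) X
      ≡⟨ cong₂ _+_ (x*[y*z]≡y*[x*z] p c (g v)) (weightedSum-scale c g X) ⟩
    c * (p * g v) + c * weightedSum g X           ≡⟨ sym (*-distribˡ-+ c _ _) ⟩
    c * (p * g v + weightedSum g X)               ∎

  coeff-⧢ : ∀ u X Y → coeff u (X ⧢ Y) ≡ weightedSum (λ v → weightedSum (λ w → coeff u (shL v w)) Y) X
  coeff-⧢ u X Y = coeff-concatMap u _ _ (λ p v →
    trans (coeff-concatMap u _ _ (λ q w →
             trans (coeff-scale u (p * q) _ (λ _ _ → refl) (shL v w)) (regroup p q _)) Y)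
          (weightedSum-scale p _ Y)) X
    where
    regroup : ∀ p q c → p * q * c ≡ q * (p * c)
    regroup p q c = trans (cong (_* c) (*-comm p q)) (*-assoc q p c)

  coeff-absent : ∀ {P : Word → Set} {w} X → AllWords P X → ¬ P w → coeff w X ≡ 0ℚ
  coeff-absent         []            []        ¬Pw = refl
  coeff-absent {w = w} ((q , v) ∷ X) (Pv ∷ PX) ¬Pw with ≡-dec _≟_ v w
  ... | yes refl = ⊥-elim (¬Pw Pv)
  ... | no  _    = trans (+-identityˡ _) (coeff-absent X PX ¬Pw)

  coeff-restrict : ∀ {P : Word → Set} (P? : Decidable P) {w} → P w →
                   ∀ X → coeff w (restrict P? X) ≡ coeff w X
  coeff-restrict P? Pw [] = refl
  coeff-restrict P? {w} Pw ((q , v) ∷ X) with P? v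
  ... | yes _ = cong (termCoeff w (q , v) +_) (coeff-restrict P? Pw X)
  ... | no ¬Pv with ≡-dec _≟_ v w
  ...   | yes refl = ⊥-elim (¬Pv Pw)
  ...   | no  _    = trans (coeff-restrict P? Pw X) (sym (+-identityˡ _))

  weightedSum-split : ∀ {P : Word → Set} (P? : Decidable P) g X →
                      weightedSum g X ≡ weightedSum g (restrict P? X) + weightedSum g (restrict (¬? ∘ P?) X)
  weightedSum-split P? g []            = sym (+-identityˡ 0ℚ)
  weightedSum-split P? g ((p , v) ∷ X) with P? v
  ... | yes _ = trans (cong (p * g v +_) (weightedSum-split P? g X)) (sym (+-assoc (p * g v) inside outside))
    where inside = weightedSum g (restrict P? X); outside = weightedSum g (restrict (¬? ∘ P?) X)
  ... | no  _ = trans (cong (p * g v +_) (weightedSum-split P? g X)) (x+[y+z]≡y+[x+z] (p * g v) inside outside)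
    where inside = weightedSum g (restrict P? X); outside = weightedSum g (restrict (¬? ∘ P?) X)

  weightedSum-zero : ∀ {P : Word → Set} g X → AllWords P X → (∀ {v} → P v → g v ≡ 0ℚ) →
                     weightedSum g X ≡ 0ℚ
  weightedSum-zero g []            []        g≡0 = refl
  weightedSum-zero g ((p , v) ∷ X) (Pv ∷ PX) g≡0 = begin
    p * g v + weightedSum g X
      ≡⟨ cong₂ _+_ (trans (cong (p *_) (g≡0 Pv)) (*-zeroʳ p)) (weightedSum-zero g X PX g≡0) ⟩
    0ℚ + 0ℚ                   ≡⟨ +-identityˡ 0ℚ ⟩
    0ℚ                        ∎

  weightedSum-copies : ∀ g v X → AllWords (_≡ v) X → weightedSum g X ≡ coeff v X * g v
  weightedSum-copies g v []            []           = sym (*-zeroˡ (g v))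
  weightedSum-copies g v ((p , _) ∷ X) (refl ∷ X≡v) with ≡-dec _≟_ v v
  ... | yes _   = trans (cong (p * g v +_) (weightedSum-copies g v X X≡v)) (sym (*-distribʳ-+ (g v) p _))
  ... | no  v≢v = ⊥-elim (v≢v refl)

  weightedSum-null : ∀ g X → (∀ w → coeff w X ≡ 0ℚ) → weightedSum g X ≡ 0ℚ
  weightedSum-null g X = bounded (length X) X ℕ.≤-refl
    where
    _≟ʷ_ : (v w : Word) → Dec (v ≡ w)
    _≟ʷ_ = ≡-dec _≟_

    -- Coefficients may cancel between repeated words, so all copies of one word are removed at once.
    bounded : ∀ n X → length X ≤ n → (∀ w → coeff w X ≡ 0ℚ) → weightedSum g X ≡ 0ℚ
    bounded _       []                _            _   = refl
    bounded (suc n) X@((_ , v) ∷ X′) (s≤s |X′|≤n) X≈0 = begin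
      weightedSum g X                           ≡⟨ weightedSum-split (_≟ʷ v) g X ⟩
      weightedSum g copies + weightedSum g rest ≡⟨ cong₂ _+_ copies≈0 (bounded n rest rest-shorter rest≈0) ⟩
      0ℚ + 0ℚ                                   ≡⟨ +-identityˡ 0ℚ ⟩
      0ℚ                                        ∎
      where
      copies rest : Lin
      copies = restrict (_≟ʷ v) X
      rest   = restrict (¬? ∘ (_≟ʷ v)) X

      copies≈0 : weightedSum g copies ≡ 0ℚ
      copies≈0 = begin
        weightedSum g copies ≡⟨ weightedSum-copies g v copies (all-filter ((_≟ʷ v) ∘ proj₂) X) ⟩
        coeff v copies * g v ≡⟨ cong (_* g v) (trans (coeff-restrict (_≟ʷ v) refl X) (X≈0 v)) ⟩
        0ℚ * g v             ≡⟨ *-zeroˡ (g v) ⟩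
        0ℚ                   ∎

      rest-shorter : length rest ≤ n
      rest-shorter =
        ℕ.≤-trans (ℕ.≤-reflexive (cong length (filter-reject (¬? ∘ (_≟ʷ v) ∘ proj₂) (λ v≢v → v≢v refl))))
                  (ℕ.≤-trans (length-filter (¬? ∘ (_≟ʷ v) ∘ proj₂) X′) |X′|≤n)

      rest≈0 : ∀ w → coeff w rest ≡ 0ℚ
      rest≈0 w with w ≟ʷ v
      ... | yes refl = coeff-absent rest (all-filter (¬? ∘ (_≟ʷ v) ∘ proj₂) X) (λ v≢v → v≢v refl)
      ... | no  w≢v  = trans (coeff-restrict (¬? ∘ (_≟ʷ v)) w≢v X) (X≈0 w)

  weightedSum-vanishes : ∀ {P : Word → Set} → Decidable P → ∀ {g} X →
                         (∀ w → ¬ P w → coeff w X ≡ 0ℚ) → (∀ {v} → P v → g v ≡ 0ℚ) → weightedSum g X ≡ 0ℚ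
  weightedSum-vanishes P? {g} X X∈⟨P⟩ g≡0 = begin
    weightedSum g X                                                        ≡⟨ weightedSum-split P? g X ⟩
    weightedSum g (restrict P? X) + weightedSum g (restrict (¬? ∘ P?) X) ≡⟨ cong₂ _+_ inside≈0 outside≈0 ⟩
    0ℚ + 0ℚ                                                                ≡⟨ +-identityˡ 0ℚ ⟩
    0ℚ                                                                     ∎
    where
    inside≈0 : weightedSum g (restrict P? X) ≡ 0ℚ
    inside≈0 = weightedSum-zero g (restrict P? X) (all-filter (P? ∘ proj₂) X) g≡0

    outside-coeff≈0 : ∀ w → coeff w (restrict (¬? ∘ P?) X) ≡ 0ℚ
    outside-coeff≈0 w with P? w
    ... | yes Pw  = coeff-absent _ (all-filter (¬? ∘ P? ∘ proj₂) X) (λ ¬Pw → ¬Pw Pw)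
    ... | no  ¬Pw = trans (coeff-restrict (¬? ∘ P?) ¬Pw X) (X∈⟨P⟩ w ¬Pw)

    outside≈0 : weightedSum g (restrict (¬? ∘ P?) X) ≡ 0ℚ
    outside≈0 = weightedSum-null g (restrict (¬? ∘ P?) X) outside-coeff≈0

module Margins where

  open import Data.Nat as ℕ using (zero; suc; s≤s; z≤n)
  open import Data.Integer using (ℤ; +_; 0ℤ; 1ℤ; -1ℤ; -[1+_]; +[1+_]; _+_; _-_; _≤_; _≤?_; -≤-; +≤+)
    renaming (suc to 1+_; pred to -1+_)
  open import Data.Integer.Properties
    using (i≤j⇒0≤j-i; 0≤i-j⇒j≤i; ≤-refl; ≤-trans; +-monoˡ-≤; +-mono-≤; +-comm; suc-mono; pred-mono;
           i≤suc[i]; i≤j⇒pred[i]≤j; suc-pred; pred-suc; i<j⇒suc[i]≤j; suc[i]≤j⇒i<j)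
  open import Data.Integer.Tactic.RingSolver using (solve-∀)

  -- Margin n w: every partial sum s₁ + ⋯ + sⱼ of w is at least j + n.
  data Margin : ℤ → Word → Set where
    []  : ∀ {n} → Margin n []
    _∷_ : ∀ {n x s} → n ≤ -1+ x → Margin (n - -1+ x) s → Margin n (x ∷ s)

  margin? : ∀ n w → Dec (Margin n w)
  margin? n []      = yes []
  margin? n (x ∷ s) =
    Dec.map′ (uncurry _∷_) (λ { (h ∷ m) → h , m }) (n ≤? -1+ x ×-dec margin? (n - -1+ x) s)

  margin-mono : ∀ {m n w} → m ≤ n → Margin n w → Margin m w
  margin-mono m≤n []       = []
  margin-mono m≤n (h ∷ ms) = ≤-trans m≤n h ∷ margin-mono (+-monoˡ-≤ _ m≤n) ms

  -- The ring solver proves only equations, so linear inequalities are obtained by matching slacks j - i.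
  ≤-by-slack : ∀ {i j i′ j′} → i ≤ j → j′ - i′ ≡ j - i → i′ ≤ j′
  ≤-by-slack i≤j eq = 0≤i-j⇒j≤i (subst (0ℤ ≤_) (sym eq) (i≤j⇒0≤j-i i≤j))

  ≤-by-slacks : ∀ {i₁ j₁ i₂ j₂ i j} → i₁ ≤ j₁ → i₂ ≤ j₂ → j - i ≡ (j₁ - i₁) + (j₂ - i₂) → i ≤ j
  ≤-by-slacks h₁ h₂ eq =
    0≤i-j⇒j≤i (subst (0ℤ ≤_) (sym eq) (+-mono-≤ (i≤j⇒0≤j-i h₁) (i≤j⇒0≤j-i h₂)))

  margin-shift : ∀ d {p x t} → Margin p (x ∷ t) → Margin (d + p) ((d + x) ∷ t)
  margin-shift d {p} {x} {t} (h ∷ m) =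
    ≤-by-slack h (head-slack d p x) ∷ subst (λ n → Margin n t) (sym (tail-bound d p x)) m
    where
    head-slack : ∀ d p x → (-1ℤ + (d + x)) - (d + p) ≡ (-1ℤ + x) - p
    head-slack = solve-∀
    tail-bound : ∀ d p x → (d + p) - (-1ℤ + (d + x)) ≡ p - (-1ℤ + x)
    tail-bound = solve-∀

  first-slack : ∀ n x → (x + 0ℤ) - (n + 1ℤ) ≡ (-1ℤ + x) - n
  first-slack = solve-∀

  next-slack : ∀ n x k S → (x + S) - (n + (1ℤ + k)) ≡ S - ((n - (-1ℤ + x)) + k)
  next-slack = solve-∀

  margin⇒partialSums : ∀ {n} w → Margin n w →
                       ∀ j → 1 ℕ.≤ j → j ℕ.≤ length w → n + + j ≤ sumℤ (take j w)
  margin⇒partialSums {n} (x ∷ s) (h ∷ m) 1 _ _ = ≤-by-slack h (first-slack n x)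
  margin⇒partialSums {n} (x ∷ s) (h ∷ m) (suc (suc j)) _ (s≤s j<|s|) =
    ≤-by-slack (margin⇒partialSums s m (suc j) (s≤s z≤n) j<|s|) (next-slack n x (+ suc j) _)

  partialSums⇒margin : ∀ {n} w → (∀ j → 1 ℕ.≤ j → j ℕ.≤ length w → n + + j ≤ sumℤ (take j w)) →
                       Margin n w
  partialSums⇒margin []      _ = []
  partialSums⇒margin {n} (x ∷ s) h =
    ≤-by-slack (h 1 (s≤s z≤n) (s≤s z≤n)) (sym (first-slack n x)) ∷
    partialSums⇒margin s (λ j _ j≤|s| →
      ≤-by-slack (h (suc j) (s≤s z≤n) (s≤s j≤|s|)) (sym (next-slack n x (+ j) _)))

  margin⇔admissible : ∀ w → Margin 1ℤ w ⇔ Admissible w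
  margin⇔admissible w = mk⇔
    (λ m j 1≤j j≤|w| → suc[i]≤j⇒i<j (margin⇒partialSums w m j 1≤j j≤|w|))
    (λ a → partialSums⇒margin w (λ j 1≤j j≤|w| → i<j⇒suc[i]≤j (a j 1≤j j≤|w|)))

  all-prepend : ∀ {P Q : Word → Set} a → (∀ {v} → P v → Q (a ∷ v)) →
                ∀ {L} → AllWords P L → AllWords Q (prepend a L)
  all-prepend a f ps = map⁺ (All.map f ps)

  all-neg : ∀ {P : Word → Set} {L} → AllWords P L → AllWords P (neg L)
  all-neg = map⁺

  all-linMap : ∀ {P Q : Word → Set} {f} → (∀ {v} → P v → AllWords Q (f v)) →
               ∀ {L} → AllWords P L → AllWords Q (linMap f L)
  all-linMap hf []       = []
  all-linMap hf (p ∷ ps) = ++⁺ (map⁺ (hf p)) (all-linMap hf ps)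

  all-I : ∀ {r L} → AllWords (Margin r) L → AllWords (Margin (1+ r)) (I L)
  all-I = all-linMap λ { [] → [] ; m@(_ ∷ _) → margin-shift 1ℤ m ∷ [] }

  all-J : ∀ {r L} → AllWords (Margin r) L → AllWords (Margin (-1+ r)) (J L)
  all-J = all-linMap λ { [] → [] ; m@(_ ∷ _) → margin-shift -1ℤ m ∷ [] }

  MarginBound : ℤ → ℤ → ℤ → Set
  MarginBound r p q = r ≤ p × r ≤ q × r ≤ p + q

  bound-sym : ∀ {r p q} → MarginBound r p q → MarginBound r q p
  bound-sym {r} {p} {q} (r≤p , r≤q , r≤p+q) = r≤q , r≤p , subst (r ≤_) (+-comm p q) r≤p+q

  bound-pred : ∀ {r p q} → MarginBound r p q → MarginBound (-1+ r) p (-1+ q)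
  bound-pred {r} {p} {q} (r≤p , r≤q , r≤p+q) =
    i≤j⇒pred[i]≤j r≤p , pred-mono r≤q , ≤-by-slack r≤p+q (slack p q r)
    where
    slack : ∀ p q r → (p + (-1ℤ + q)) - (-1ℤ + r) ≡ (p + q) - r
    slack = solve-∀

  bound-zero : ∀ {r p q} → p ≤ -1ℤ → MarginBound r p q → MarginBound (r + 1ℤ) (p + 1ℤ) q
  bound-zero {r} {p} {q} p≤-1 (r≤p , r≤q , r≤p+q) =
    +-monoˡ-≤ 1ℤ r≤p , ≤-by-slacks r≤p+q p≤-1 (slack₁ p q r) , ≤-by-slack r≤p+q (slack₂ p q r)
    where
    slack₁ : ∀ p q r → q - (r + 1ℤ) ≡ ((p + q) - r) + (-1ℤ - p)
    slack₁ = solve-∀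
    slack₂ : ∀ p q r → ((p + 1ℤ) + q) - (r + 1ℤ) ≡ (p + q) - r
    slack₂ = solve-∀

  bound-neg : ∀ {r p q} → 1+ q ≤ -1ℤ → MarginBound r p q →
              MarginBound (1+ r) p (1+ q) × MarginBound r (-1+ p) (1+ q)
  bound-neg {r} {p} {q} q≤-2 (r≤p , r≤q , r≤p+q) =
    (≤-trans r+1≤p-1 (i≤j⇒pred[i]≤j ≤-refl) , suc-mono r≤q , ≤-by-slack r≤p+q (slack₂ p q r)) ,
    (≤-trans (i≤suc[i] r) r+1≤p-1 , ≤-trans r≤q (i≤suc[i] q) , ≤-by-slack r≤p+q (slack₃ p q r))
    where
    slack₁ : ∀ p q r → (-1ℤ + p) - (1ℤ + r) ≡ ((p + q) - r) + (-1ℤ - (1ℤ + q))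
    slack₁ = solve-∀
    slack₂ : ∀ p q r → (p + (1ℤ + q)) - (1ℤ + r) ≡ (p + q) - r
    slack₂ = solve-∀
    slack₃ : ∀ p q r → ((-1ℤ + p) + (1ℤ + q)) - r ≡ (p + q) - r
    slack₃ = solve-∀
    r+1≤p-1 : 1+ r ≤ -1+ p
    r+1≤p-1 = ≤-by-slacks r≤p+q q≤-2 (slack₁ p q r)

  ShuffleMargin : Word → Word → Lin → Set
  ShuffleMargin s t L = ∀ {p q r} → Margin p s → Margin q t → MarginBound r p q → AllWords (Margin r) L

  shuffleMargin-sym : ∀ {s t L} → ShuffleMargin s t L → ShuffleMargin t s L
  shuffleMargin-sym h mt ms b = h ms mt (bound-sym b)

  shuffleMargin-zeroˡ : ∀ {s t L} → ShuffleMargin s t L → ShuffleMargin (+ 0 ∷ s) t (prepend (+ 0) L)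
  shuffleMargin-zeroˡ h (p≤-1 ∷ ms) mt b@(r≤p , _) =
    all-prepend (+ 0) (≤-trans r≤p p≤-1 ∷_) (h ms mt (bound-zero p≤-1 b))

  shuffleMargin-zeroʳ : ∀ {s t L} → ShuffleMargin s t L → ShuffleMargin s (+ 0 ∷ t) (prepend (+ 0) L)
  shuffleMargin-zeroʳ = shuffleMargin-sym ∘ shuffleMargin-zeroˡ ∘ shuffleMargin-sym

  shuffleMargin-I : ∀ {x s y t A B} →
                    ShuffleMargin (x ∷ s) (-1+ y ∷ t) A → ShuffleMargin (-1+ x ∷ s) (y ∷ t) B →
                    ShuffleMargin (x ∷ s) (y ∷ t) (I A ⊕ I B)
  shuffleMargin-I {A = A} {B} hA hB {r = r} ms mt b =
    subst (λ n → AllWords (Margin n) (I A ⊕ I B)) (suc-pred r)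
      (++⁺ (all-I (hA ms (margin-shift -1ℤ mt) (bound-pred b)))
           (all-I (hB (margin-shift -1ℤ ms) mt (bound-sym (bound-pred (bound-sym b))))))

  shuffleMargin-Jʳ : ∀ {x s y t A B} → y ≤ -1ℤ →
                     ShuffleMargin (x ∷ s) (1+ y ∷ t) A → ShuffleMargin (-1+ x ∷ s) (1+ y ∷ t) B →
                     ShuffleMargin (x ∷ s) (y ∷ t) (J A ⊖ B)
  shuffleMargin-Jʳ {A = A} y≤-1 hA hB {r = r} ms mt@(q≤y-1 ∷ _) b =
    let bA , bB = bound-neg (suc-mono (≤-trans q≤y-1 (pred-mono y≤-1))) b in
    ++⁺ (subst (λ n → AllWords (Margin n) (J A)) (pred-suc r) (all-J (hA ms (margin-shift 1ℤ mt) bA)))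
        (all-neg (hB (margin-shift -1ℤ ms) (margin-shift 1ℤ mt) bB))

  shuffleMargin-Jˡ : ∀ {x s y t A B} → x ≤ -1ℤ →
                     ShuffleMargin (1+ x ∷ s) (y ∷ t) A → ShuffleMargin (1+ x ∷ s) (-1+ y ∷ t) B →
                     ShuffleMargin (x ∷ s) (y ∷ t) (J A ⊖ B)
  shuffleMargin-Jˡ x≤-1 hA hB =
    shuffleMargin-sym (shuffleMargin-Jʳ x≤-1 (shuffleMargin-sym hA) (shuffleMargin-sym hB))

  mutual
    shL-margin : ∀ s t → ShuffleMargin s t (shL s t)
    shL-margin []      t _  mt (_ , r≤q , _) = margin-mono r≤q mt ∷ []
    shL-margin (x ∷ s) t = shH-margin x s t

    shH-margin : ∀ x s t → ShuffleMargin (x ∷ s) t (shH x s t)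
    shH-margin x s []      ms _ (r≤p , _) = margin-mono r≤p ms ∷ []
    shH-margin x s (y ∷ t) = shC-margin x s y t

    shC-margin : ∀ x s y t → ShuffleMargin (x ∷ s) (y ∷ t) (shC x s y t)
    shC-margin (+ zero)  s y t = shZ-margin s y t
    shC-margin +[1+ n ] s y t = shP-margin n s y t
    shC-margin -[1+ n ] s y t = shN-margin n s y t

    shZ-margin : ∀ s y t → ShuffleMargin (+ 0 ∷ s) (y ∷ t) (shZ s y t)
    shZ-margin s y t = shuffleMargin-zeroˡ (shL-margin s (y ∷ t))

    shN-margin : ∀ n s y t → ShuffleMargin (-[1+ n ] ∷ s) (y ∷ t) (shN n s y t)
    shN-margin zero    s y t = shuffleMargin-Jˡ (-≤- z≤n) (shZ-margin s y t) (shZ-margin s (-1+ y) t)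
    shN-margin (suc n) s y t = shuffleMargin-Jˡ (-≤- z≤n) (shN-margin n s y t) (shN-margin n s (-1+ y) t)

    shP-margin : ∀ n s y t → ShuffleMargin (+[1+ n ] ∷ s) (y ∷ t) (shP n s y t)
    shP-margin n s (+ zero)  t = shP0-margin n s t
    shP-margin n s +[1+ m ] t = shPP-margin n m s t
    shP-margin n s -[1+ m ] t = shPN-margin n m s t

    shP0-margin : ∀ n s t → ShuffleMargin (+[1+ n ] ∷ s) (+ 0 ∷ t) (shP0 n s t)
    shP0-margin n s t = shuffleMargin-zeroʳ (shH-margin +[1+ n ] s t)

    shPP-margin : ∀ n m s t → ShuffleMargin (+[1+ n ] ∷ s) (+[1+ m ] ∷ t) (shPP n m s t)
    shPP-margin zero    zero    s t = shuffleMargin-I (shP0-margin zero s t) (shZ-margin s (+ 1) t)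
    shPP-margin zero    (suc m) s t = shuffleMargin-I (shPP-margin zero m s t) (shZ-margin s +[1+ suc m ] t)
    shPP-margin (suc n) zero    s t = shuffleMargin-I (shP0-margin (suc n) s t) (shPP-margin n zero s t)
    shPP-margin (suc n) (suc m) s t = shuffleMargin-I (shPP-margin (suc n) m s t) (shPP-margin n (suc m) s t)

    shPN-margin : ∀ n m s t → ShuffleMargin (+[1+ n ] ∷ s) (-[1+ m ] ∷ t) (shPN n m s t)
    shPN-margin zero    zero    s t = shuffleMargin-Jʳ (-≤- z≤n) (shP0-margin zero s t) (shZ-margin s (+ 0) t)
    shPN-margin (suc n) zero    s t = shuffleMargin-Jʳ (-≤- z≤n) (shP0-margin (suc n) s t) (shP0-margin n s t)
    shPN-margin zero    (suc m) s t = shuffleMargin-Jʳ (-≤- z≤n) (shPN-margin zero m s t) (shZ-margin s -[1+ m ] t)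
    shPN-margin (suc n) (suc m) s t = shuffleMargin-Jʳ (-≤- z≤n) (shPN-margin (suc n) m s t) (shPN-margin n m s t)

  shL-admissible : ∀ {v w} → Admissible v → Admissible w → AllWords Admissible (shL v w)
  shL-admissible {v} {w} av aw =
    All.map (to (margin⇔admissible _))
      (shL-margin v w (from (margin⇔admissible v) av) (from (margin⇔admissible w) aw)
        (≤-refl , ≤-refl , +≤+ (s≤s z≤n)))
    where open Equivalence

  admissible? : Decidable Admissible
  admissible? w = Dec.map (margin⇔admissible w) (margin? 1ℤ w)

open Margins using (shL-admissible; admissible?)
open Coefficients using (coeff-⧢; coeff-absent; weightedSum; weightedSum-vanishes)
open import Data.Rational using (0ℚ)
open Relation.Binary.PropositionalEquality.≡-Reasoning

theorem4p5 : (X Y : Lin) → InH0 X → InH0 Y → InH0 (X ⧢ Y)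
theorem4p5 X Y X∈H⁰ Y∈H⁰ u u∉H⁰ = begin
  coeff u (X ⧢ Y)
    ≡⟨ coeff-⧢ u X Y ⟩
  weightedSum (λ v → weightedSum (λ w → coeff u (shL v w)) Y) X
    ≡⟨ weightedSum-vanishes admissible? X X∈H⁰ (λ v∈H⁰ →
         weightedSum-vanishes admissible? Y Y∈H⁰ (λ w∈H⁰ →
           coeff-absent _ (shL-admissible v∈H⁰ w∈H⁰) u∉H⁰)) ⟩
  0ℚ
    ∎
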